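{- If models $A$ and $B$ are strongly equivalent, then $A$ is complete if and only if $B$ is complete.
   Context: A model of computation over a set $X$ is any set of functions $f:X\to X\cup\{\bot\}$, where $\bot$ denotes "undefined". Injections are extended by $\rho(\bot)=\bot$. $A\succsim_\rho B$ means: for every $g\in B$ there is $f\in A$ with $\rho\circ g=f\circ\rho$; $A\succsim B$ means $A\succsim_\rho B$ for some injection $\rho$. $A$ and $B$ are strongly equivalent if there are bijections $\pi:\mathrm{dom}\,B\to\mathrm{dom}\,A$, $\tau:\mathrm{dom}\,A\to\mathrm{dom}\,B$ with $A\succsim_\pi B$ and $B\succsim_\tau A$. A model $A$ is complete if for every model $M$ over $\mathrm{dom}\,A$ with $M\supseteq A$ and $A\succsim M$, we have $M=A$. -}

module Defs where

open import Level using (Level; suc; _⊔_)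
open import Data.Maybe using (Maybe) renaming (map to mapMaybe)
open import Data.Product using (Σ; ∃; _×_; _,_)
open import Function.Base using (_∘_)
open import Function.Definitions using (Injective; Bijective)
open import Relation.Binary.PropositionalEquality using (_≡_)

-- A function f : X → X ∪ {⊥}; nothing represents ⊥ ("undefined").
PFun : Set → Set
PFun X = X → Maybe X

Model : Set → Set₁
Model X = PFun X → Set

_≗ₘ_ : {X : Set} → PFun X → PFun X → Set
f ≗ₘ g = ∀ x → f x ≡ g x

_⊆ₘ_ : {X : Set} → Model X → Model X → Set
M ⊆ₘ A = ∀ g → M g → Σ _ λ f → A f × (f ≗ₘ g)

-- A ≿_ρ B : for every g ∈ B there is f ∈ A with ρ ∘ g = f ∘ ρ,
-- where ρ is extended to Maybe by ρ(⊥) = ⊥ (i.e. Maybe.map ρ).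
_≿[_]_ : {X Y : Set} → Model X → (Y → X) → Model Y → Set
A ≿[ ρ ] B = ∀ g → B g → Σ _ λ f → A f × (∀ y → mapMaybe ρ (g y) ≡ f (ρ y))

_≿_ : {X Y : Set} → Model X → Model Y → Set
_≿_ {X} {Y} A B = Σ (Y → X) λ ρ → Injective _≡_ _≡_ ρ × (A ≿[ ρ ] B)

StronglyEquivalent : {X Y : Set} → Model X → Model Y → Set
StronglyEquivalent {X} {Y} A B =
  Σ (Y → X) λ π → Σ (X → Y) λ τ →
    Bijective _≡_ _≡_ π × Bijective _≡_ _≡_ τ × (A ≿[ π ] B) × (B ≿[ τ ] A)

-- A is complete: every model M over dom A with M ⊇ A and A ≿ M equals A.
-- Given A ⊆ M, equality M = A amounts to M ⊆ A.
Complete : {X : Set} → Model X → Set₁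
Complete {X} A = (M : Model X) → A ⊆ₘ M → A ≿ M → M ⊆ₘ A

-- Conjugating by the bijection τ : X → Y turns a candidate extension M of B
-- into a candidate extension of A: the pullback of M along τ contains A
-- (because B simulates A via τ) and is simulated by A via the injection
-- π ∘ ρ ∘ τ.  Completeness of A puts the pullback inside A, and simulating
-- it back into B via τ, surjectivity of τ recovers every member of M as a
-- member of B.  Strong equivalence is symmetric, so completeness transfers
-- both ways.
module Submission where

open import Defs
open import Data.Maybe using (Maybe) renaming (map to mapMaybe)
open import Data.Maybe.Properties using (map-∘; map-cong; map-id)
open import Data.Product using (Σ; _×_; _,_; proj₁; proj₂)
open import Function.Base using (_∘_; id)
open import Function.Bundles using (_⇔_; mk⇔)
open import Function.Consequences.Propositional using (surjective⇒strictlySurjective)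
open import Function.Construct.Composition using (injective)
open import Function.Definitions using (Injective; Surjective; StrictlySurjective)
open import Relation.Binary.PropositionalEquality
  using (_≡_; refl; sym; trans; cong; module ≡-Reasoning)

private
  variable
    X Y Z : Set

≿[]-trans : {A : Model X} {B : Model Y} {C : Model Z} {ρ : Y → X} {σ : Z → Y} →
  A ≿[ ρ ] B → B ≿[ σ ] C → A ≿[ ρ ∘ σ ] C
≿[]-trans {ρ = ρ} {σ} A≿B B≿C h Ch with B≿C h Ch
... | g , Bg , g∼h with A≿B g Bg
... | f , Af , f∼g = f , Af , λ z → begin
  mapMaybe (ρ ∘ σ) (h z)          ≡⟨ map-∘ (h z) ⟩
  mapMaybe ρ (mapMaybe σ (h z))   ≡⟨ cong (mapMaybe ρ) (g∼h z) ⟩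
  mapMaybe ρ (g (σ z))            ≡⟨ f∼g (σ z) ⟩
  f (ρ (σ z))                     ∎
  where open ≡-Reasoning

≿[]-⊆ₘ : {A M : Model X} {B : Model Y} {ρ : Y → X} →
  A ⊆ₘ M → A ≿[ ρ ] B → M ≿[ ρ ] B
≿[]-⊆ₘ A⊆M A≿B g Bg with A≿B g Bg
... | f , Af , f∼g with A⊆M f Af
... | f′ , Mf′ , f′≗f = f′ , Mf′ , λ y → trans (f∼g y) (sym (f′≗f _))

-- τ⁻¹ M τ when τ is a bijection.
pullback : (X → Y) → Model Y → Model X
pullback τ M f = Σ _ λ g → M g × (∀ x → mapMaybe τ (f x) ≡ g (τ x))

pullback-≿[] : (τ : X → Y) (M : Model Y) → M ≿[ τ ] pullback τ M
pullback-≿[] τ M f (g , Mg , f∼g) = g , Mg , f∼g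

≿[]⇒⊆ₘ-pullback : {M : Model Y} {A : Model X} {τ : X → Y} →
  M ≿[ τ ] A → A ⊆ₘ pullback τ M
≿[]⇒⊆ₘ-pullback M≿A f Af = f , M≿A f Af , λ _ → refl

mapMaybe-section : {f : X → Y} {f⁻ : Y → X} → (∀ y → f (f⁻ y) ≡ y) →
  (m : Maybe Y) → mapMaybe f (mapMaybe f⁻ m) ≡ m
mapMaybe-section {f = f} {f⁻} section m = begin
  mapMaybe f (mapMaybe f⁻ m)  ≡⟨ map-∘ m ⟨
  mapMaybe (f ∘ f⁻) m         ≡⟨ map-cong section m ⟩
  mapMaybe id m               ≡⟨ map-id m ⟩
  m                           ∎
  where open ≡-Reasoning

module _ {τ : X → Y} (τ-surj : StrictlySurjective _≡_ τ) where

  private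
    τ⁻ : Y → X
    τ⁻ = proj₁ ∘ τ-surj

    τ∘τ⁻ : ∀ y → τ (τ⁻ y) ≡ y
    τ∘τ⁻ = proj₂ ∘ τ-surj

    conjugate∈pullback : {M : Model Y} {g : PFun Y} → M g →
      pullback τ M (mapMaybe τ⁻ ∘ g ∘ τ)
    conjugate∈pullback {g = g} Mg = g , Mg , λ x → mapMaybe-section τ∘τ⁻ (g (τ x))

  -- Simulating the copy in A of the conjugate of g ∈ M back into B gives k
  -- with k ∘ τ = g ∘ τ, hence k = g.
  pullback-⊆ₘ⇒⊆ₘ : {M B : Model Y} {A : Model X} →
    B ≿[ τ ] A → pullback τ M ⊆ₘ A → M ⊆ₘ B
  pullback-⊆ₘ⇒⊆ₘ B≿A M′⊆A g Mg with M′⊆A (mapMaybe τ⁻ ∘ g ∘ τ) (conjugate∈pullback Mg)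
  ... | f , Af , f≗conj with B≿A f Af
  ... | k , Bk , k∼f = k , Bk , λ y → begin
    k y                                      ≡⟨ cong k (τ∘τ⁻ y) ⟨
    k (τ (τ⁻ y))                             ≡⟨ k∼f (τ⁻ y) ⟨
    mapMaybe τ (f (τ⁻ y))                    ≡⟨ cong (mapMaybe τ) (f≗conj (τ⁻ y)) ⟩
    mapMaybe τ (mapMaybe τ⁻ (g (τ (τ⁻ y))))  ≡⟨ mapMaybe-section τ∘τ⁻ _ ⟩
    g (τ (τ⁻ y))                             ≡⟨ cong g (τ∘τ⁻ y) ⟩
    g y                                      ∎
    where open ≡-Reasoning

complete-transfer : {A : Model X} {B : Model Y} {π : Y → X} {τ : X → Y} →
  Injective _≡_ _≡_ π → Injective _≡_ _≡_ τ → Surjective _≡_ _≡_ τ →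
  A ≿[ π ] B → B ≿[ τ ] A → Complete A → Complete B
complete-transfer {A = A} {π = π} {τ} π-inj τ-inj τ-surj A≿B B≿A A-complete
  M B⊆M (ρ , ρ-inj , B≿M) =
  pullback-⊆ₘ⇒⊆ₘ (surjective⇒strictlySurjective τ-surj) B≿A
    (A-complete (pullback τ M) A⊆M′ (π ∘ ρ ∘ τ , σ-inj , A≿M′))
  where
  A⊆M′ : A ⊆ₘ pullback τ M
  A⊆M′ = ≿[]⇒⊆ₘ-pullback (≿[]-⊆ₘ B⊆M B≿A)

  σ-inj : Injective _≡_ _≡_ (π ∘ ρ ∘ τ)
  σ-inj = injective _≡_ _≡_ _≡_ τ-inj (injective _≡_ _≡_ _≡_ ρ-inj π-inj)

  A≿M′ : A ≿[ π ∘ ρ ∘ τ ] pullback τ M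
  A≿M′ = ≿[]-trans A≿B (≿[]-trans B≿M (pullback-≿[] τ M))

StronglyEquivalent-sym : {A : Model X} {B : Model Y} →
  StronglyEquivalent A B → StronglyEquivalent B A
StronglyEquivalent-sym (π , τ , π-bij , τ-bij , A≿B , B≿A) =
  τ , π , τ-bij , π-bij , B≿A , A≿B

StronglyEquivalent⇒Complete⇒Complete : {A : Model X} {B : Model Y} →
  StronglyEquivalent A B → Complete A → Complete B
StronglyEquivalent⇒Complete⇒Complete
  (_ , _ , (π-inj , _) , (τ-inj , τ-surj) , A≿B , B≿A) =
  complete-transfer π-inj τ-inj τ-surj A≿B B≿A

mainTheorem17 : {X Y : Set} (A : Model X) (B : Model Y) →
    StronglyEquivalent A B → (Complete A ⇔ Complete B)
mainTheorem17 A B A≈B =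
  mk⇔ (StronglyEquivalent⇒Complete⇒Complete A≈B)
      (StronglyEquivalent⇒Complete⇒Complete (StronglyEquivalent-sym A≈B))
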